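{- Let $C\subseteq\mathbb{F}_2^n$ be a binary code, let $C^*\subseteq\mathbb{F}_2^{n+1}$ be its extension by a parity check bit, and for $i\in\{1,\dots,n\}$ let $C_{[i]}=\{\tau_i(x):x\in C\}$, where $\tau_i(v)=(v_1,\dots,v_{i-1},p(v),v_{i+1},\dots,v_n)$ and $p(v)=\sum_{j=1}^n v_j\pmod 2$. If $C^*$ is completely regular, then for all $i=1,\dots,n$: (i) the weight distributions of $C$ and $C_{[i]}$ coincide; (ii) the minimum distances of $C$ and $C_{[i]}$ coincide and are odd; (iii) the external distances of $C$ and $C_{[i]}$ coincide; (iv) the covering radii of $C$ and $C_{[i]}$ coincide.
   Context: Codes are assumed distance invariant and to contain the zero vector. For a code $D\subseteq\mathbb{F}_2^N$ and $x\in\mathbb{F}_2^N$, let $B_{x,i}=|\{v\in D:d(x,v)=i\}|$ (Hamming distance); $D$ is completely regular if $(B_{x,0},\dots,B_{x,N})$ depends only on $d(x,D)$. The covering radius of $D$ is $\max_x d(x,D)$. The weight distribution is $(A_0,\dots,A_N)$ with $A_w$ the number of codewords of weight $w$. The external distance $s$ of $D$ is defined by: $s+1$ is the number of nonzero terms in the dual distance distribution of $D$ (the MacWilliams transform of its distance distribution). -}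

module Defs where

open import Data.Bool using (Bool; true; false; _∧_; _xor_; not; if_then_else_)
import Data.Bool.Properties as BoolP
open import Data.Nat using (ℕ; zero; suc; _+_; _∸_; _⊓_; _⊔_; _%_; _*_)
import Data.Nat as Nat
open import Data.Nat.Combinatorics using (_C_)
open import Data.Integer using (ℤ; +_; -_)
import Data.Integer as Int
open import Data.List using (List; []; _∷_; _++_; map; foldr; upTo)
open import Data.Vec using (Vec; []; _∷_; replicate; init; last; _[_]≔_)
open import Data.Vec.Properties using (≡-dec)
open import Data.Fin using (Fin)
import Data.Bool.ListAction as BLA
open import Data.Product using (_×_; ∃)
open import Relation.Binary.PropositionalEquality using (_≡_; _≢_)
open import Relation.Nullary.Decidable using (⌊_⌋)

Code : ℕ → Set
Code N = Vec Bool N → Bool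

allVecs : (N : ℕ) → List (Vec Bool N)
allVecs zero = [] ∷ []
allVecs (suc N) = map (true ∷_) (allVecs N) ++ map (false ∷_) (allVecs N)

count : {A : Set} → (A → Bool) → List A → ℕ
count p [] = 0
count p (x ∷ xs) = (if p x then 1 else 0) + count p xs

eqVec : {N : ℕ} → Vec Bool N → Vec Bool N → Bool
eqVec u v = ⌊ ≡-dec BoolP._≟_ u v ⌋

zeroVec : (N : ℕ) → Vec Bool N
zeroVec N = replicate N false

weight : {N : ℕ} → Vec Bool N → ℕ
weight [] = 0
weight (b ∷ v) = (if b then 1 else 0) + weight v

xorVec : {N : ℕ} → Vec Bool N → Vec Bool N → Vec Bool N
xorVec [] [] = []
xorVec (a ∷ u) (b ∷ v) = (a xor b) ∷ xorVec u v

dist : {N : ℕ} → Vec Bool N → Vec Bool N → ℕ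
dist u v = weight (xorVec u v)

parity : {N : ℕ} → Vec Bool N → Bool
parity [] = false
parity (b ∷ v) = b xor parity v

B : {N : ℕ} → Code N → Vec Bool N → ℕ → ℕ
B {N} D x k = count (λ v → D v ∧ (dist x v Nat.≡ᵇ k)) (allVecs N)

weightDist : {N : ℕ} → Code N → ℕ → ℕ
weightDist {N} D w = count (λ v → D v ∧ (weight v Nat.≡ᵇ w)) (allVecs N)

-- d(x,D) = min over codewords v of d(x,v)  (default N, irrelevant for nonempty D)
distToCode : {N : ℕ} → Code N → Vec Bool N → ℕ
distToCode {N} D x = foldr (λ v acc → if D v then dist x v ⊓ acc else acc) N (allVecs N)

coveringRadius : {N : ℕ} → Code N → ℕ
coveringRadius {N} D = foldr (λ x acc → distToCode D x ⊔ acc) 0 (allVecs N)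

ContainsZero : {N : ℕ} → Code N → Set
ContainsZero {N} D = D (zeroVec N) ≡ true

DistanceInvariant : {N : ℕ} → Code N → Set
DistanceInvariant D = ∀ c c' → D c ≡ true → D c' ≡ true → ∀ k → B D c k ≡ B D c' k

CompletelyRegular : {N : ℕ} → Code N → Set
CompletelyRegular D = ∀ x y → distToCode D x ≡ distToCode D y → ∀ k → B D x k ≡ B D y k

IsMinDist : {N : ℕ} → Code N → ℕ → Set
IsMinDist D d =
  ∃ (λ u → ∃ (λ v → D u ≡ true × D v ≡ true × u ≢ v × dist u v ≡ d))
  × (∀ u v → D u ≡ true → D v ≡ true → u ≢ v → d Nat.≤ dist u v)

Odd : ℕ → Set
Odd d = d % 2 ≡ 1

sumℤ : (ℕ → ℤ) → ℕ → ℤ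
sumℤ f m = foldr (λ j acc → f j Int.+ acc) (+ 0) (upTo m)

krawtchouk : ℕ → ℕ → ℕ → ℤ
krawtchouk N k i =
  sumℤ (λ j → (if (j % 2 Nat.≡ᵇ 0) then (+ 1) else (- (+ 1)))
              Int.* (+ ((i C j) * ((N ∸ i) C (k ∸ j))))) (suc k)

-- |D| times the distance distribution: number of ordered pairs of codewords at distance i
pairCount : {N : ℕ} → Code N → ℕ → ℕ
pairCount {N} D i = foldr (λ u acc → (if D u then B D u i else 0) + acc) 0 (allVecs N)

-- |D|² times the dual distance distribution B'_k = (1/|D|) Σ_i B_i K_k(i)
dualTerm : {N : ℕ} → Code N → ℕ → ℤ
dualTerm {N} D k = sumℤ (λ i → (+ pairCount D i) Int.* krawtchouk N k i) (suc N)

-- s + 1 = number of nonzero terms of the dual distance distribution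
externalDistance : {N : ℕ} → Code N → ℕ
externalDistance {N} D = count (λ k → not ⌊ dualTerm D k Int.≟ + 0 ⌋) (upTo (suc N)) ∸ 1

extend : {n : ℕ} → Code n → Code (suc n)
extend C y = C (init y) ∧ not (last y xor parity (init y))

tau : {n : ℕ} → Fin n → Vec Bool n → Vec Bool n
tau i v = v [ i ]≔ parity v

tauCode : {n : ℕ} → Fin n → Code n → Code n
tauCode {n} i C y = BLA.any (λ x → C x ∧ eqVec (tau i x) y) (allVecs n)

-- Write x* = (x, p(x)); the words of C* are the x* with x ∈ C, all of even weight, and
-- d(u, x) is d(u*, x*) minus [u* and x* differ in the parity bit]. As p(τᵢ v) = vᵢ, the word
-- τᵢ(v)* is v* with coordinates i and n+1 exchanged, so d(τᵢ u, τᵢ x) is d(u*, x*) minus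
-- [u* and x* differ in coordinate i]. Fix u ∈ C. Flipping a coordinate c of u* gives a word at
-- distance 1 from C*, and at distance d(u*, x*) ∓ 1 from x* according as u* and x* differ at c
-- or not. Complete regularity makes these distance distributions independent of c, and an
-- induction on the distance recovers from them the number of x ∈ C with d(u*, x*) = m that
-- differ from u* at c, which is therefore independent of c too. Comparing c = n+1 with c = i,
-- the distance distribution of C from u is that of C_[i] from τᵢ(u); this gives the weight
-- distributions (u = 0), the minimum distances and the distance distributions, hence the
-- external distances. A pair of codewords at even minimum distance agrees in the parity bit
-- but differs in some coordinate i, and comparing c = i with c = n+1 yields a closer pair.
-- The covering radii agree for every code: given x, change xᵢ so that the parity of the
-- resulting x′ is xᵢ + r; a codeword v within r of x′ then has τᵢ(v) within r of x.

module Submission where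

open import Algebra.Bundles using (CommutativeRing)
open import Algebra.Definitions using (Involutive)
open import Data.Bool using (Bool; true; false; _∧_; _xor_; not; if_then_else_)
open import Data.Bool.Properties using (_≟_; xor-same; xor-comm; xor-assoc; xor-identityʳ; xor-inverseˡ; xor-inverseʳ; not-involutive; not-injective; ¬-not; not-distribˡ-xor; ∧-identityʳ; ∧-zeroʳ; ∧-conicalˡ; ∧-conicalʳ; ∨-zeroʳ; T-≡; ⇔→≡; xor-∧-commutativeRing)
import Data.Bool.ListAction as Bool
open import Data.Empty using (⊥; ⊥-elim)
open import Data.Fin using (Fin; zero; suc; fromℕ; inject₁)
import Data.Integer as ℤ
open import Data.List using (List; []; _∷_; _++_; map; foldr; upTo)
open import Data.List.Membership.Propositional using (_∈_)
open import Data.List.Membership.Propositional.Properties using (∈-++⁺ˡ; ∈-++⁺ʳ; ∈-map⁺)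
open import Data.List.Properties using (foldr-cong)
open import Data.List.Relation.Unary.Any using (here; there)
open import Data.Nat using (ℕ; zero; suc; _+_; _*_; _∸_; _≤_; z≤n; s≤s; _⊓_; _⊔_; _≡ᵇ_)
import Data.Nat.Properties as ℕ
open import Data.Product using (_×_; ∃; _,_; proj₁; proj₂)
open import Data.Sum using (_⊎_; inj₁; inj₂)
open import Data.Vec using (Vec; []; _∷_; lookup; _[_]≔_; _∷ʳ_; init; last; initLast)
import Data.Vec.Properties as Vec
open import Function.Bundles using (mk⇔; Equivalence)
open import Relation.Binary.PropositionalEquality using (_≡_; _≢_; refl; sym; trans; cong; cong₂; subst; subst₂; module ≡-Reasoning)
open import Relation.Nullary using (Dec; yes; no; does)
open import Relation.Nullary.Decidable using (⌊_⌋; isYes≗does; dec-true; dec-false)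

open import Algebra.Properties.CommutativeSemigroup ℕ.+-commutativeSemigroup using (interchange; x∙yz≈y∙xz)
open import Algebra.Properties.CommutativeSemigroup (CommutativeRing.+-commutativeSemigroup xor-∧-commutativeRing)
  using () renaming (interchange to xor-interchange; x∙yz≈y∙xz to xor-x∙yz≈y∙xz)

open import Defs

ind : Bool → ℕ
ind b = if b then 1 else 0

ind≤1 : ∀ b → ind b ≤ 1
ind≤1 true  = ℕ.≤-refl
ind≤1 false = z≤n

xor-cancelˡ : ∀ a b → a xor (a xor b) ≡ b
xor-cancelˡ a b = trans (sym (xor-assoc a a b)) (cong (_xor b) (xor-same a))

r≡x⊕r⊕q⇒x⊕q≡false : ∀ x r q → r ≡ (x xor r) xor q → x xor q ≡ false
r≡x⊕r⊕q⇒x⊕q≡false true  _     true  _ = refl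
r≡x⊕r⊕q⇒x⊕q≡false false _     false _ = refl
r≡x⊕r⊕q⇒x⊕q≡false true  true  false ()
r≡x⊕r⊕q⇒x⊕q≡false true  false false ()
r≡x⊕r⊕q⇒x⊕q≡false false true  true  ()
r≡x⊕r⊕q⇒x⊕q≡false false false true  ()

≡ᵇ-refl : ∀ m → (m ≡ᵇ m) ≡ true
≡ᵇ-refl m = Equivalence.to T-≡ (ℕ.≡⇒≡ᵇ m m refl)

≡ᵇ⇒≡ : ∀ {m k} → (m ≡ᵇ k) ≡ true → m ≡ k
≡ᵇ⇒≡ {m} {k} h = ℕ.≡ᵇ⇒≡ m k (Equivalence.from T-≡ h)

oddᵇ : ℕ → Bool
oddᵇ zero    = false
oddᵇ (suc m) = not (oddᵇ m)

oddᵇ⇒Odd : ∀ m → oddᵇ m ≡ true → Odd m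
oddᵇ⇒Odd (suc zero)    _ = refl
oddᵇ⇒Odd (suc (suc m)) h = oddᵇ⇒Odd m (trans (sym (not-involutive (oddᵇ m))) h)

twoStep-unique : (a b a′ b′ : ℕ → ℕ) → (∀ m → a m + b m ≡ a′ m + b′ m) → a 0 ≡ a′ 0 → a 1 ≡ a′ 1
  → (∀ k → a (2 + k) + b k ≡ a′ (2 + k) + b′ k) → ∀ m → a m ≡ a′ m
twoStep-unique a b a′ b′ total e₀ e₁ step zero          = e₀
twoStep-unique a b a′ b′ total e₀ e₁ step (suc zero)    = e₁
twoStep-unique a b a′ b′ total e₀ e₁ step (suc (suc k)) =
  ℕ.+-cancelʳ-≡ (b k) (a (2 + k)) (a′ (2 + k)) (trans (step k) (cong (a′ (2 + k) +_) (sym bₖ≡b′ₖ)))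
  where
  bₖ≡b′ₖ : b k ≡ b′ k
  bₖ≡b′ₖ = ℕ.+-cancelˡ-≡ (a k) (b k) (b′ k)
    (trans (total k) (cong (_+ b′ k) (sym (twoStep-unique a b a′ b′ total e₀ e₁ step k))))

sumBy : {A : Set} → (A → ℕ) → List A → ℕ
sumBy g = foldr (λ x acc → g x + acc) 0

countAt : {A : Set} → List A → (A → Bool) → (A → ℕ) → ℕ → ℕ
countAt L P f w = count (λ x → P x ∧ (f x ≡ᵇ w)) L

module _ {A : Set} where

  sumBy-cong : ∀ {g h : A → ℕ} → (∀ x → g x ≡ h x) → ∀ L → sumBy g L ≡ sumBy h L
  sumBy-cong g≗h = foldr-cong (λ x acc → cong (_+ acc) (g≗h x)) refl

  sumBy-+ : ∀ (g h : A → ℕ) L → sumBy (λ x → g x + h x) L ≡ sumBy g L + sumBy h L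
  sumBy-+ g h []      = refl
  sumBy-+ g h (x ∷ L) = trans (cong ((g x + h x) +_) (sumBy-+ g h L)) (interchange (g x) (h x) _ _)

  sumBy-++ : ∀ (g : A → ℕ) L L′ → sumBy g (L ++ L′) ≡ sumBy g L + sumBy g L′
  sumBy-++ g []      L′ = refl
  sumBy-++ g (x ∷ L) L′ = trans (cong (g x +_) (sumBy-++ g L L′)) (sym (ℕ.+-assoc (g x) _ _))

  sumBy-map : ∀ {B : Set} (g : B → ℕ) (f : A → B) L → sumBy g (map f L) ≡ sumBy (λ x → g (f x)) L
  sumBy-map g f []      = refl
  sumBy-map g f (x ∷ L) = cong (g (f x) +_) (sumBy-map g f L)

  sumBy-*-zero : ∀ (g : A → ℕ) L → sumBy (λ x → g x * 0) L ≡ 0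
  sumBy-*-zero g []      = refl
  sumBy-*-zero g (x ∷ L) = cong₂ _+_ (ℕ.*-zeroʳ (g x)) (sumBy-*-zero g L)

  count≡sumBy : ∀ (p : A → Bool) L → count p L ≡ sumBy (λ x → ind (p x)) L
  count≡sumBy p []      = refl
  count≡sumBy p (x ∷ L) = cong (ind (p x) +_) (count≡sumBy p L)

  count-cong : ∀ {p q : A → Bool} → (∀ x → p x ≡ q x) → ∀ L → count p L ≡ count q L
  count-cong p≗q []      = refl
  count-cong p≗q (x ∷ L) = cong₂ _+_ (cong ind (p≗q x)) (count-cong p≗q L)

  count-map : ∀ {B : Set} (p : B → Bool) (f : A → B) L → count p (map f L) ≡ count (λ x → p (f x)) L
  count-map p f []      = refl
  count-map p f (x ∷ L) = cong (ind (p (f x)) +_) (count-map p f L)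

  count-split : ∀ (p q r : A → Bool) → (∀ x → ind (p x) ≡ ind (q x) + ind (r x)) → ∀ L
    → count p L ≡ count q L + count r L
  count-split p q r split L = begin
    count p L                                               ≡⟨ count≡sumBy p L ⟩
    sumBy (λ x → ind (p x)) L                               ≡⟨ sumBy-cong split L ⟩
    sumBy (λ x → ind (q x) + ind (r x)) L                   ≡⟨ sumBy-+ _ _ L ⟩
    sumBy (λ x → ind (q x)) L + sumBy (λ x → ind (r x)) L   ≡⟨ sym (cong₂ _+_ (count≡sumBy q L) (count≡sumBy r L)) ⟩
    count q L + count r L                                   ∎
    where open ≡-Reasoning

  count-false : ∀ (p : A → Bool) → (∀ x → p x ≡ false) → ∀ L → count p L ≡ 0
  count-false p p≡false []      = refl
  count-false p p≡false (x ∷ L) rewrite p≡false x = count-false p p≡false L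

  count-pos : ∀ (p : A → Bool) {x L} → x ∈ L → p x ≡ true → 1 ≤ count p L
  count-pos p (here refl) px rewrite px = s≤s z≤n
  count-pos p {L = y ∷ L} (there x∈L) px = ℕ.≤-trans (count-pos p x∈L px) (ℕ.m≤n+m _ (ind (p y)))

  count-witness : ∀ (p : A → Bool) L → 1 ≤ count p L → ∃ λ x → p x ≡ true
  count-witness p (x ∷ L) h with p x in px
  ... | true  = x , px
  ... | false = count-witness p L h

  countAt-pos : ∀ L (P : A → Bool) (f : A → ℕ) {x} → x ∈ L → P x ≡ true → 1 ≤ countAt L P f (f x)
  countAt-pos L P f x∈L Px = count-pos _ x∈L (trans (cong (_∧ _) Px) (≡ᵇ-refl (f _)))

  countAt-witness : ∀ L (P : A → Bool) (f : A → ℕ) {w} → 1 ≤ countAt L P f w → ∃ λ x → P x ≡ true × f x ≡ w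
  countAt-witness L P f h with count-witness _ L h
  ... | x , Px∧fx≡w = x , ∧-conicalˡ _ _ Px∧fx≡w , ≡ᵇ⇒≡ (∧-conicalʳ _ _ Px∧fx≡w)

  any-true : ∀ (p : A → Bool) {x L} → x ∈ L → p x ≡ true → Bool.any p L ≡ true
  any-true p (here refl) px rewrite px = refl
  any-true p {L = y ∷ L} (there x∈L) px rewrite any-true p x∈L px = ∨-zeroʳ (p y)

  any-witness : ∀ (p : A → Bool) L → Bool.any p L ≡ true → ∃ λ x → p x ≡ true
  any-witness p (x ∷ L) h with p x in px
  ... | true  = x , px
  ... | false = any-witness p L h

_≟ⱽ_ : ∀ {N} (u v : Vec Bool N) → Dec (u ≡ v)
_≟ⱽ_ = Vec.≡-dec _≟_

∈-allVecs : ∀ {N} (v : Vec Bool N) → v ∈ allVecs N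
∈-allVecs []                = here refl
∈-allVecs {suc N} (true ∷ v)  = ∈-++⁺ˡ (∈-map⁺ (true ∷_) (∈-allVecs v))
∈-allVecs {suc N} (false ∷ v) = ∈-++⁺ʳ (map (true ∷_) (allVecs N)) (∈-map⁺ (false ∷_) (∈-allVecs v))

sumBy-allVecs-∷ : ∀ {N} (g : Vec Bool (suc N) → ℕ)
  → sumBy g (allVecs (suc N)) ≡ sumBy (λ x → g (true ∷ x)) (allVecs N) + sumBy (λ x → g (false ∷ x)) (allVecs N)
sumBy-allVecs-∷ {N} g =
  trans (sumBy-++ g (map (true ∷_) (allVecs N)) _) (cong₂ _+_ (sumBy-map g _ (allVecs N)) (sumBy-map g _ (allVecs N)))

sumBy-allVecs-∷ʳ : ∀ N (g : Vec Bool (suc N) → ℕ)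
  → sumBy g (allVecs (suc N)) ≡ sumBy (λ x → g (x ∷ʳ true) + g (x ∷ʳ false)) (allVecs N)
sumBy-allVecs-∷ʳ zero    g = trans (cong (g (true ∷ []) +_) (ℕ.+-identityʳ _)) (sym (ℕ.+-identityʳ _))
sumBy-allVecs-∷ʳ (suc N) g = trans (sumBy-allVecs-∷ g)
  (trans (cong₂ _+_ (sumBy-allVecs-∷ʳ N (λ x → g (true ∷ x))) (sumBy-allVecs-∷ʳ N (λ x → g (false ∷ x))))
         (sym (sumBy-allVecs-∷ (λ x → g (x ∷ʳ true) + g (x ∷ʳ false)))))

sumBy-select : ∀ {N} (g : Vec Bool N → ℕ) x → sumBy (λ y → g y * ind (does (y ≟ⱽ x))) (allVecs N) ≡ g x
sumBy-select g [] = trans (ℕ.+-identityʳ _) (ℕ.*-identityʳ _)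
sumBy-select {suc N} g (true ∷ x) = trans (sumBy-allVecs-∷ {N} (λ y → g y * ind (does (y ≟ⱽ (true ∷ x)))))
  (trans (cong₂ _+_ (sumBy-select (λ y → g (true ∷ y)) x) (sumBy-*-zero (λ y → g (false ∷ y)) (allVecs N)))
         (ℕ.+-identityʳ _))
sumBy-select {suc N} g (false ∷ x) = trans (sumBy-allVecs-∷ {N} (λ y → g y * ind (does (y ≟ⱽ (false ∷ x)))))
  (cong₂ _+_ (sumBy-*-zero (λ y → g (true ∷ y)) (allVecs N)) (sumBy-select (λ y → g (false ∷ y)) x))

sumBy-by-multiplicity : ∀ {N} (g : Vec Bool N → ℕ) L
  → sumBy g L ≡ sumBy (λ y → g y * count (λ x → does (y ≟ⱽ x)) L) (allVecs N)
sumBy-by-multiplicity {N} g []      = sym (sumBy-*-zero g (allVecs N))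
sumBy-by-multiplicity {N} g (x ∷ L) = sym (begin
    sumBy (λ y → g y * (ind (does (y ≟ⱽ x)) + count (λ x′ → does (y ≟ⱽ x′)) L)) (allVecs N)
  ≡⟨ sumBy-cong (λ y → ℕ.*-distribˡ-+ (g y) _ _) (allVecs N) ⟩
    sumBy (λ y → g y * ind (does (y ≟ⱽ x)) + g y * count (λ x′ → does (y ≟ⱽ x′)) L) (allVecs N)
  ≡⟨ sumBy-+ _ _ (allVecs N) ⟩
    sumBy (λ y → g y * ind (does (y ≟ⱽ x))) (allVecs N) + sumBy (λ y → g y * count (λ x′ → does (y ≟ⱽ x′)) L) (allVecs N)
  ≡⟨ cong₂ _+_ (sumBy-select g x) (sym (sumBy-by-multiplicity g L)) ⟩
    g x + sumBy g L ∎)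
  where open ≡-Reasoning

sumBy-∘-involution : ∀ {N} (f : Vec Bool N → Vec Bool N) → Involutive _≡_ f → (g : Vec Bool N → ℕ)
  → sumBy (λ x → g (f x)) (allVecs N) ≡ sumBy g (allVecs N)
sumBy-∘-involution {N} f f-inv g = begin
    sumBy (λ x → g (f x)) (allVecs N)
  ≡⟨ sym (sumBy-map g f (allVecs N)) ⟩
    sumBy g (map f (allVecs N))
  ≡⟨ sumBy-by-multiplicity g (map f (allVecs N)) ⟩
    sumBy (λ y → g y * count (λ x → does (y ≟ⱽ x)) (map f (allVecs N))) (allVecs N)
  ≡⟨ sumBy-cong (λ y → trans (cong (g y *_) (multiplicity-one y)) (ℕ.*-identityʳ (g y))) (allVecs N) ⟩
    sumBy g (allVecs N) ∎
  where
  open ≡-Reasoning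
  preimage : ∀ y x → does (y ≟ⱽ f x) ≡ does (x ≟ⱽ f y)
  preimage y x with y ≟ⱽ f x
  ... | yes refl = sym (dec-true (x ≟ⱽ f (f x)) (sym (f-inv x)))
  ... | no  y≢fx = sym (dec-false (x ≟ⱽ f y) (λ x≡fy → y≢fx (sym (trans (cong f x≡fy) (f-inv y)))))
  multiplicity-one : ∀ y → count (λ x → does (y ≟ⱽ x)) (map f (allVecs N)) ≡ 1
  multiplicity-one y = begin
      count (λ x → does (y ≟ⱽ x)) (map f (allVecs N))
    ≡⟨ count-map _ f (allVecs N) ⟩
      count (λ x → does (y ≟ⱽ f x)) (allVecs N)
    ≡⟨ count-cong (preimage y) (allVecs N) ⟩
      count (λ x → does (x ≟ⱽ f y)) (allVecs N)
    ≡⟨ count≡sumBy _ (allVecs N) ⟩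
      sumBy (λ x → ind (does (x ≟ⱽ f y))) (allVecs N)
    ≡⟨ sumBy-cong (λ x → sym (ℕ.*-identityˡ _)) (allVecs N) ⟩
      sumBy (λ x → 1 * ind (does (x ≟ⱽ f y))) (allVecs N)
    ≡⟨ sumBy-select (λ _ → 1) (f y) ⟩
      1 ∎

count-∘-involution : ∀ {N} (f : Vec Bool N → Vec Bool N) → Involutive _≡_ f → (p : Vec Bool N → Bool)
  → count (λ x → p (f x)) (allVecs N) ≡ count p (allVecs N)
count-∘-involution {N} f f-inv p = trans (count≡sumBy _ (allVecs N))
  (trans (sumBy-∘-involution f f-inv (λ x → ind (p x))) (sym (count≡sumBy p (allVecs N))))

lookup-∷ʳ-fromℕ : ∀ {A : Set} {N} (xs : Vec A N) x → lookup (xs ∷ʳ x) (fromℕ N) ≡ x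
lookup-∷ʳ-fromℕ []       x = refl
lookup-∷ʳ-fromℕ (y ∷ xs) x = lookup-∷ʳ-fromℕ xs x

lookup-∷ʳ-inject₁ : ∀ {A : Set} {N} (xs : Vec A N) x i → lookup (xs ∷ʳ x) (inject₁ i) ≡ lookup xs i
lookup-∷ʳ-inject₁ (y ∷ xs) x zero    = refl
lookup-∷ʳ-inject₁ (y ∷ xs) x (suc i) = lookup-∷ʳ-inject₁ xs x i

flipAt : ∀ {N} → Vec Bool N → Fin N → Vec Bool N
flipAt v j = v [ j ]≔ not (lookup v j)

parityExt : ∀ {N} → Vec Bool N → Vec Bool (suc N)
parityExt x = x ∷ʳ parity x

dist-self : ∀ {N} (u : Vec Bool N) → dist u u ≡ 0
dist-self []      = refl
dist-self (b ∷ u) rewrite xor-same b = dist-self u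

dist≡0⇒≡ : ∀ {N} (u v : Vec Bool N) → dist u v ≡ 0 → u ≡ v
dist≡0⇒≡ []          []          _ = refl
dist≡0⇒≡ (true ∷ u)  (true ∷ v)  d = cong (true ∷_) (dist≡0⇒≡ u v d)
dist≡0⇒≡ (false ∷ u) (false ∷ v) d = cong (false ∷_) (dist≡0⇒≡ u v d)

dist≢0⇒≢ : ∀ {N} {u v : Vec Bool N} → dist u v ≢ 0 → u ≢ v
dist≢0⇒≢ {u = u} d≢0 refl = d≢0 (dist-self u)

≢⇒dist≢0 : ∀ {N} {u v : Vec Bool N} → u ≢ v → dist u v ≢ 0
≢⇒dist≢0 {u = u} {v} u≢v d≡0 = u≢v (dist≡0⇒≡ u v d≡0)

weight≡dist-zeroVec : ∀ {N} (v : Vec Bool N) → weight v ≡ dist (zeroVec N) v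
weight≡dist-zeroVec []      = refl
weight≡dist-zeroVec (b ∷ v) = cong (ind b +_) (weight≡dist-zeroVec v)

weight≤length : ∀ {N} (v : Vec Bool N) → weight v ≤ N
weight≤length []          = z≤n
weight≤length (true ∷ v)  = s≤s (weight≤length v)
weight≤length (false ∷ v) = ℕ.m≤n⇒m≤1+n (weight≤length v)

dist-∷ʳ : ∀ {N} (u x : Vec Bool N) a b → dist (u ∷ʳ a) (x ∷ʳ b) ≡ ind (a xor b) + dist u x
dist-∷ʳ []      []      a b = refl
dist-∷ʳ (c ∷ u) (e ∷ x) a b = trans (cong (ind (c xor e) +_) (dist-∷ʳ u x a b)) (x∙yz≈y∙xz (ind (c xor e)) (ind (a xor b)) (dist u x))

dist-[]≔ : ∀ {N} (u x : Vec Bool N) i a b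
  → ind (lookup u i xor lookup x i) + dist (u [ i ]≔ a) (x [ i ]≔ b) ≡ ind (a xor b) + dist u x
dist-[]≔ (c ∷ u) (e ∷ x) zero    a b = x∙yz≈y∙xz (ind (c xor e)) (ind (a xor b)) (dist u x)
dist-[]≔ (c ∷ u) (e ∷ x) (suc i) a b = begin
    ind (lookup u i xor lookup x i) + (ind (c xor e) + dist (u [ i ]≔ a) (x [ i ]≔ b))
  ≡⟨ x∙yz≈y∙xz (ind (lookup u i xor lookup x i)) (ind (c xor e)) _ ⟩
    ind (c xor e) + (ind (lookup u i xor lookup x i) + dist (u [ i ]≔ a) (x [ i ]≔ b))
  ≡⟨ cong (ind (c xor e) +_) (dist-[]≔ u x i a b) ⟩
    ind (c xor e) + (ind (a xor b) + dist u x)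
  ≡⟨ x∙yz≈y∙xz (ind (c xor e)) (ind (a xor b)) (dist u x) ⟩
    ind (a xor b) + (ind (c xor e) + dist u x) ∎
  where open ≡-Reasoning

dist-flipAt : ∀ {N} (u x : Vec Bool N) j
  → ind (lookup u j xor lookup x j) + dist (flipAt u j) x ≡ ind (not (lookup u j xor lookup x j)) + dist u x
dist-flipAt u x j = begin
    ind (lookup u j xor lookup x j) + dist (flipAt u j) x
  ≡⟨ cong (λ y → ind (lookup u j xor lookup x j) + dist (flipAt u j) y) (sym (Vec.[]≔-lookup x j)) ⟩
    ind (lookup u j xor lookup x j) + dist (flipAt u j) (x [ j ]≔ lookup x j)
  ≡⟨ dist-[]≔ u x j _ _ ⟩
    ind (not (lookup u j) xor lookup x j) + dist u x
  ≡⟨ cong (λ b → ind b + dist u x) (sym (not-distribˡ-xor (lookup u j) (lookup x j))) ⟩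
    ind (not (lookup u j xor lookup x j)) + dist u x ∎
  where open ≡-Reasoning

dist-flipAt-self : ∀ {N} (u : Vec Bool N) j → dist (flipAt u j) u ≡ 1
dist-flipAt-self u j = begin
    dist (flipAt u j) u
  ≡⟨ cong (λ b → ind b + dist (flipAt u j) u) (sym (xor-same (lookup u j))) ⟩
    ind (lookup u j xor lookup u j) + dist (flipAt u j) u
  ≡⟨ dist-flipAt u u j ⟩
    ind (not (lookup u j xor lookup u j)) + dist u u
  ≡⟨ cong₂ (λ b d → ind (not b) + d) (xor-same (lookup u j)) (dist-self u) ⟩
    1 ∎
  where open ≡-Reasoning

differing-coordinate : ∀ {N} (u v : Vec Bool N) → u ≢ v → ∃ λ j → lookup u j xor lookup v j ≡ true
differing-coordinate []      []      []≢[] = ⊥-elim ([]≢[] refl)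
differing-coordinate (a ∷ u) (b ∷ v) u≢v with a ≟ b
... | no  a≢b  = zero , trans (cong (_xor b) (¬-not a≢b)) (xor-inverseˡ b)
... | yes refl with differing-coordinate u v (λ u≡v → u≢v (cong (a ∷_) u≡v))
...   | j , differ = suc j , differ

oddᵇ-weight : ∀ {N} (w : Vec Bool N) → oddᵇ (weight w) ≡ parity w
oddᵇ-weight []          = refl
oddᵇ-weight (true ∷ w)  = cong not (oddᵇ-weight w)
oddᵇ-weight (false ∷ w) = oddᵇ-weight w

parity-xorVec : ∀ {N} (u v : Vec Bool N) → parity (xorVec u v) ≡ parity u xor parity v
parity-xorVec []      []      = refl
parity-xorVec (a ∷ u) (b ∷ v) =
  trans (cong ((a xor b) xor_) (parity-xorVec u v)) (xor-interchange a b (parity u) (parity v))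

oddᵇ-dist : ∀ {N} (u v : Vec Bool N) → oddᵇ (dist u v) ≡ parity u xor parity v
oddᵇ-dist u v = trans (oddᵇ-weight (xorVec u v)) (parity-xorVec u v)

parity-∷ʳ : ∀ {N} (x : Vec Bool N) b → parity (x ∷ʳ b) ≡ parity x xor b
parity-∷ʳ []      b = xor-identityʳ b
parity-∷ʳ (a ∷ x) b = trans (cong (a xor_) (parity-∷ʳ x b)) (sym (xor-assoc a (parity x) b))

parity-parityExt : ∀ {N} (x : Vec Bool N) → parity (parityExt x) ≡ false
parity-parityExt x = trans (parity-∷ʳ x (parity x)) (xor-same (parity x))

parity-[]≔ : ∀ {N} (v : Vec Bool N) i a → parity (v [ i ]≔ a) ≡ parity v xor (lookup v i xor a)
parity-[]≔ (b ∷ w) zero    a = sym (begin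
    (b xor parity w) xor (b xor a) ≡⟨ xor-interchange b (parity w) b a ⟩
    (b xor b) xor (parity w xor a) ≡⟨ cong (_xor (parity w xor a)) (xor-same b) ⟩
    parity w xor a                 ≡⟨ xor-comm (parity w) a ⟩
    a xor parity w                 ∎)
  where open ≡-Reasoning
parity-[]≔ (b ∷ w) (suc i) a = trans (cong (b xor_) (parity-[]≔ w i a)) (sym (xor-assoc b (parity w) _))

parity-flipAt : ∀ {N} (v : Vec Bool N) j → parity (flipAt v j) ≡ not (parity v)
parity-flipAt v j = trans (parity-[]≔ v j _) (trans (cong (parity v xor_) (xor-inverseʳ (lookup v j))) (xor-comm (parity v) true))

tau-involutive : ∀ {n} (i : Fin n) → Involutive _≡_ (tau i)
tau-involutive i v = begin
    (v [ i ]≔ parity v) [ i ]≔ parity (v [ i ]≔ parity v)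
  ≡⟨ Vec.[]≔-idempotent v i ⟩
    v [ i ]≔ parity (v [ i ]≔ parity v)
  ≡⟨ cong (v [ i ]≔_) (parity-[]≔ v i (parity v)) ⟩
    v [ i ]≔ (parity v xor (lookup v i xor parity v))
  ≡⟨ cong (v [ i ]≔_) (trans (xor-x∙yz≈y∙xz (parity v) (lookup v i) (parity v)) (cong (lookup v i xor_) (xor-same (parity v)))) ⟩
    v [ i ]≔ (lookup v i xor false)
  ≡⟨ cong (v [ i ]≔_) (xor-identityʳ (lookup v i)) ⟩
    v [ i ]≔ lookup v i
  ≡⟨ Vec.[]≔-lookup v i ⟩
    v ∎
  where open ≡-Reasoning

tau-zeroVec : ∀ {n} (i : Fin n) → tau i (zeroVec n) ≡ zeroVec n
tau-zeroVec {n} i = trans (cong (zeroVec n [ i ]≔_) (trans (parity-zeroVec n) (sym (Vec.lookup-replicate i false))))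
                          (Vec.[]≔-lookup (zeroVec n) i)
  where
  parity-zeroVec : ∀ m → parity (zeroVec m) ≡ false
  parity-zeroVec zero    = refl
  parity-zeroVec (suc m) = parity-zeroVec m

eqVec⇒≡ : ∀ {N} {u v : Vec Bool N} → eqVec u v ≡ true → u ≡ v
eqVec⇒≡ {u = u} {v} h with u ≟ⱽ v
... | yes u≡v = u≡v

eqVec-refl : ∀ {N} (u : Vec Bool N) → eqVec u u ≡ true
eqVec-refl u = trans (isYes≗does (u ≟ⱽ u)) (dec-true (u ≟ⱽ u) refl)

tauCode-correct : ∀ {n} (i : Fin n) (C : Code n) y → tauCode i C y ≡ C (tau i y)
tauCode-correct {n} i C y = ⇔→≡ (mk⇔ sound complete)
  where
  sound : tauCode i C y ≡ true → C (tau i y) ≡ true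
  sound h with any-witness _ (allVecs n) h
  ... | x , Cx∧τx≡y = subst (λ z → C z ≡ true)
          (trans (sym (tau-involutive i x)) (cong (tau i) (eqVec⇒≡ (∧-conicalʳ _ _ Cx∧τx≡y))))
          (∧-conicalˡ _ _ Cx∧τx≡y)
  complete : C (tau i y) ≡ true → tauCode i C y ≡ true
  complete h = any-true _ (∈-allVecs (tau i y))
    (trans (cong₂ _∧_ h (cong (λ z → eqVec z y) (tau-involutive i y))) (eqVec-refl y))

tauCode-tau : ∀ {n} (i : Fin n) (C : Code n) x → tauCode i C (tau i x) ≡ C x
tauCode-tau i C x = trans (tauCode-correct i C (tau i x)) (cong C (tau-involutive i x))

extend-∷ʳ : ∀ {n} (C : Code n) x b → extend C (x ∷ʳ b) ≡ C x ∧ not (b xor parity x)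
extend-∷ʳ C x b rewrite Vec.init-∷ʳ b x | Vec.last-∷ʳ b x = refl

extend-parityExt : ∀ {n} (C : Code n) x → extend C (parityExt x) ≡ C x
extend-parityExt C x = trans (extend-∷ʳ C x (parity x)) (trans (cong (λ b → C x ∧ not b) (xor-same (parity x))) (∧-identityʳ (C x)))

extend⇒even : ∀ {n} (C : Code n) y → extend C y ≡ true → parity y ≡ false
extend⇒even C y h = begin
    parity y                       ≡⟨ cong parity (proj₂ (proj₂ (initLast y))) ⟩
    parity (init y ∷ʳ last y)      ≡⟨ parity-∷ʳ (init y) (last y) ⟩
    parity (init y) xor last y     ≡⟨ xor-comm (parity (init y)) (last y) ⟩
    last y xor parity (init y)     ≡⟨ not-injective (∧-conicalʳ _ _ h) ⟩
    false                          ∎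
  where open ≡-Reasoning

flipAt-∉-extend : ∀ {n} (C : Code n) y c → parity y ≡ false → extend C (flipAt y c) ≡ false
flipAt-∉-extend C y c even with extend C (flipAt y c) in e
... | false = refl
... | true with () ← trans (sym (cong not even)) (trans (sym (parity-flipAt y c)) (extend⇒even C (flipAt y c) e))

B-extend : ∀ {n} (C : Code n) y k → B (extend C) y k ≡ countAt (allVecs n) C (λ x → dist y (parityExt x)) k
B-extend {n} C y k = begin
    count (λ v → extend C v ∧ e v) (allVecs (suc n))
  ≡⟨ count≡sumBy _ (allVecs (suc n)) ⟩
    sumBy (λ v → ind (extend C v ∧ e v)) (allVecs (suc n))
  ≡⟨ sumBy-allVecs-∷ʳ n _ ⟩
    sumBy (λ x → ind (extend C (x ∷ʳ true) ∧ e (x ∷ʳ true)) + ind (extend C (x ∷ʳ false) ∧ e (x ∷ʳ false))) (allVecs n)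
  ≡⟨ sumBy-cong (λ x → trans (cong₂ _+_ (lastBit x true) (lastBit x false)) (keepParity (C x) (parity x) (λ b → e (x ∷ʳ b)))) (allVecs n) ⟩
    sumBy (λ x → ind (C x ∧ e (parityExt x))) (allVecs n)
  ≡⟨ sym (count≡sumBy _ (allVecs n)) ⟩
    countAt (allVecs n) C (λ x → dist y (parityExt x)) k ∎
  where
  open ≡-Reasoning
  e : Vec Bool (suc n) → Bool
  e v = dist y v ≡ᵇ k
  lastBit : ∀ x b → ind (extend C (x ∷ʳ b) ∧ e (x ∷ʳ b)) ≡ ind ((C x ∧ not (b xor parity x)) ∧ e (x ∷ʳ b))
  lastBit x b = cong (λ z → ind (z ∧ e (x ∷ʳ b))) (extend-∷ʳ C x b)
  keepParity : ∀ c p (f : Bool → Bool)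
    → ind ((c ∧ not (true xor p)) ∧ f true) + ind ((c ∧ not (false xor p)) ∧ f false) ≡ ind (c ∧ f p)
  keepParity false p     f = refl
  keepParity true  true  f = ℕ.+-identityʳ _
  keepParity true  false f = refl

module _ {N : ℕ} (D : Code N) (x : Vec Bool N) where

  private
    distOver : ℕ → List (Vec Bool N) → ℕ
    distOver = foldr (λ v acc → if D v then dist x v ⊓ acc else acc)

    distOver-≤ : ∀ d {L v} → v ∈ L → D v ≡ true → distOver d L ≤ dist x v
    distOver-≤ d (here refl) Dv rewrite Dv = ℕ.m⊓n≤m (dist x _) _
    distOver-≤ d {y ∷ L} (there v∈L) Dv with D y
    ... | true  = ℕ.≤-trans (ℕ.m⊓n≤n (dist x y) _) (distOver-≤ d v∈L Dv)
    ... | false = distOver-≤ d v∈L Dv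

    distOver-attained : ∀ d L → distOver d L ≡ d ⊎ ∃ λ v → D v ≡ true × dist x v ≤ distOver d L
    distOver-attained d []      = inj₁ refl
    distOver-attained d (y ∷ L) with D y in Dy
    ... | false = distOver-attained d L
    ... | true with ℕ.≤-total (dist x y) (distOver d L)
    ...   | inj₁ y≤ = inj₂ (y , Dy , ℕ.≤-reflexive (sym (ℕ.m≤n⇒m⊓n≡m y≤)))
    ...   | inj₂ ≥y with distOver-attained d L
    ...     | inj₁ ≡d           = inj₁ (trans (ℕ.m≥n⇒m⊓n≡n ≥y) ≡d)
    ...     | inj₂ (v , Dv , v≤) = inj₂ (v , Dv , subst (dist x v ≤_) (sym (ℕ.m≥n⇒m⊓n≡n ≥y)) v≤)

  distToCode-≤ : ∀ {v} → D v ≡ true → distToCode D x ≤ dist x v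
  distToCode-≤ Dv = distOver-≤ N (∈-allVecs _) Dv

  distToCode-attained : ∀ {v₀} → D v₀ ≡ true → ∃ λ v → D v ≡ true × dist x v ≤ distToCode D x
  distToCode-attained {v₀} Dv₀ with distOver-attained N (allVecs N)
  ... | inj₂ nearest = nearest
  ... | inj₁ ≡N      = v₀ , Dv₀ , subst (dist x v₀ ≤_) (sym ≡N) (weight≤length (xorVec x v₀))

  distToCode≡1 : D x ≡ false → ∀ {w} → D w ≡ true → dist x w ≡ 1 → distToCode D x ≡ 1
  distToCode≡1 x∉D w∈D dist≡1 = ℕ.≤-antisym (subst (distToCode D x ≤_) dist≡1 (distToCode-≤ w∈D)) (ℕ.n≢0⇒n>0 ≢0)
    where
    ≢0 : distToCode D x ≢ 0
    ≢0 d≡0 with distToCode-attained w∈D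
    ... | v , Dv , v≤
      with () ← trans (sym x∉D) (subst (λ z → D z ≡ true) (sym (dist≡0⇒≡ x v (ℕ.n≤0⇒n≡0 (subst (dist x v ≤_) d≡0 v≤)))) Dv)

module _ {N : ℕ} where

  private
    maxOver : (Vec Bool N → ℕ) → List (Vec Bool N) → ℕ
    maxOver f = foldr (λ x acc → f x ⊔ acc) 0

    ≤-maxOver : ∀ f {x L} → x ∈ L → f x ≤ maxOver f L
    ≤-maxOver f (here refl)  = ℕ.m≤m⊔n (f _) _
    ≤-maxOver f {L = y ∷ L} (there x∈L) = ℕ.≤-trans (≤-maxOver f x∈L) (ℕ.m≤n⊔m (f y) _)

    maxOver-least : ∀ f {r} L → (∀ x → f x ≤ r) → maxOver f L ≤ r
    maxOver-least f []      f≤r = z≤n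
    maxOver-least f (y ∷ L) f≤r = ℕ.⊔-lub (f≤r y) (maxOver-least f L f≤r)

  distToCode≤coveringRadius : ∀ (D : Code N) x → distToCode D x ≤ coveringRadius D
  distToCode≤coveringRadius D x = ≤-maxOver (distToCode D) (∈-allVecs x)

  coveringRadius-least : ∀ (D : Code N) {r} → (∀ x → distToCode D x ≤ r) → coveringRadius D ≤ r
  coveringRadius-least D = maxOver-least (distToCode D) (allVecs N)

dist-tau-≤ : ∀ {n} (i : Fin n) (x v : Vec Bool n) r → dist (x [ i ]≔ (parity x xor oddᵇ r)) v ≤ r → dist x (tau i v) ≤ r
dist-tau-≤ i x v r d≤r = ℕ.≤-trans (ℕ.m≤n+m _ _) (ℕ.≤-trans (ℕ.≤-reflexive moved) bound)
  where
  X b : Bool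
  X = lookup x i
  b = parity x xor oddᵇ r
  x′ : Vec Bool _
  x′ = x [ i ]≔ b
  restore : x′ [ i ]≔ X ≡ x
  restore = trans (Vec.[]≔-idempotent x i) (Vec.[]≔-lookup x i)
  moved : ind (b xor lookup v i) + dist x (tau i v) ≡ ind (X xor parity v) + dist x′ v
  moved = subst₂ (λ β z → ind (β xor lookup v i) + dist z (tau i v) ≡ ind (X xor parity v) + dist x′ v)
    (Vec.lookup∘update i x b) restore (dist-[]≔ x′ v i X (parity v))
  parity-x′ : parity x′ ≡ X xor oddᵇ r
  parity-x′ = trans (parity-[]≔ x i b)
    (trans (xor-x∙yz≈y∙xz (parity x) X b) (cong (X xor_) (xor-cancelˡ (parity x) (oddᵇ r))))
  bound : ind (X xor parity v) + dist x′ v ≤ r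
  bound with dist x′ v ℕ.≟ r
  ... | no  d≢r = ℕ.≤-trans (ℕ.+-monoˡ-≤ (dist x′ v) (ind≤1 _)) (ℕ.≤∧≢⇒< d≤r d≢r)
  ... | yes d≡r = subst (λ β → ind β + dist x′ v ≤ r) (sym aligned) d≤r
    where
    aligned : X xor parity v ≡ false
    aligned = r≡x⊕r⊕q⇒x⊕q≡false X (oddᵇ r) (parity v) (begin
      oddᵇ r                      ≡⟨ cong oddᵇ (sym d≡r) ⟩
      oddᵇ (dist x′ v)            ≡⟨ oddᵇ-dist x′ v ⟩
      parity x′ xor parity v      ≡⟨ cong (_xor parity v) parity-x′ ⟩
      (X xor oddᵇ r) xor parity v ∎)
      where open ≡-Reasoning

coveringRadius-≤-tau : ∀ {n} (i : Fin n) (C D : Code n) → (∀ y → D y ≡ C (tau i y))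
  → ∀ {v₀} → C v₀ ≡ true → coveringRadius D ≤ coveringRadius C
coveringRadius-≤-tau i C D D≗C∘τ C∋v₀ = coveringRadius-least D covered
  where
  covered : ∀ x → distToCode D x ≤ coveringRadius C
  covered x = throughNearest (distToCode-attained C x′ C∋v₀)
    where
    x′ : Vec Bool _
    x′ = x [ i ]≔ (parity x xor oddᵇ (coveringRadius C))
    throughNearest : (∃ λ v → C v ≡ true × dist x′ v ≤ distToCode C x′) → distToCode D x ≤ coveringRadius C
    throughNearest (v , v∈C , v-nearest) = ℕ.≤-trans (distToCode-≤ D x τv∈D)
      (dist-tau-≤ i x v _ (ℕ.≤-trans v-nearest (distToCode≤coveringRadius C x′)))
      where
      τv∈D : D (tau i v) ≡ true
      τv∈D = trans (D≗C∘τ (tau i v)) (trans (cong C (tau-involutive i v)) v∈C)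

module Flagged {A : Set} (L : List A) (P : A → Bool) (D : A → ℕ) where

  flagged unflagged : (A → Bool) → ℕ → ℕ
  flagged   δ = countAt L (λ x → δ x ∧ P x) D
  unflagged δ = countAt L (λ x → not (δ x) ∧ P x) D

  IsReflection : (A → ℕ) → (A → Bool) → Set
  IsReflection V δ = ∀ x → ind (δ x) + V x ≡ ind (not (δ x)) + D x

  flagged+unflagged : ∀ δ m → flagged δ m + unflagged δ m ≡ countAt L P D m
  flagged+unflagged δ m = sym (count-split _ _ _ (λ x → split (δ x)) L)
    where
    split : ∀ d {c e} → ind (c ∧ e) ≡ ind ((d ∧ c) ∧ e) + ind ((not d ∧ c) ∧ e)
    split true  = sym (ℕ.+-identityʳ _)
    split false = refl

  countAt-lowered : ∀ (f : A → ℕ) δ → (∀ x → D x ≡ ind (δ x) + f x) → ∀ w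
    → countAt L P f w ≡ flagged δ (suc w) + unflagged δ w
  countAt-lowered f δ D≡δ+f w = count-split _ _ _ (λ x → lower (δ x) (D≡δ+f x)) L
    where
    lower : ∀ d {c Fx Dx} → Dx ≡ ind d + Fx
      → ind (c ∧ (Fx ≡ᵇ w)) ≡ ind ((d ∧ c) ∧ (Dx ≡ᵇ suc w)) + ind ((not d ∧ c) ∧ (Dx ≡ᵇ w))
    lower true  refl = sym (ℕ.+-identityʳ _)
    lower false refl = refl

  -- the second count is unflagged δ (k - 1), and 0 for k = 0
  countAt-reflected : ∀ V δ → IsReflection V δ → ∀ k
    → countAt L P V k ≡ flagged δ (suc k) + countAt L (λ x → not (δ x) ∧ P x) (λ x → suc (D x)) k
  countAt-reflected V δ reflection k = count-split _ _ _ (λ x → reflect (δ x) (reflection x)) L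
    where
    reflect : ∀ d {c Vx Dx} → ind d + Vx ≡ ind (not d) + Dx
      → ind (c ∧ (Vx ≡ᵇ k)) ≡ ind ((d ∧ c) ∧ (Dx ≡ᵇ suc k)) + ind ((not d ∧ c) ∧ (suc Dx ≡ᵇ k))
    reflect true  refl = sym (ℕ.+-identityʳ _)
    reflect false refl = refl

  flagged-determined : ∀ V V′ δ δ′ → IsReflection V δ → IsReflection V′ δ′
    → flagged δ 0 ≡ 0 → flagged δ′ 0 ≡ 0 → (∀ k → countAt L P V k ≡ countAt L P V′ k)
    → (∀ m → flagged δ m ≡ flagged δ′ m) × (∀ m → unflagged δ m ≡ unflagged δ′ m)
  flagged-determined V V′ δ δ′ reflection-δ reflection-δ′ zero-δ zero-δ′ V≗V′ = same-flagged , same-unflagged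
    where
    total : ∀ m → flagged δ m + unflagged δ m ≡ flagged δ′ m + unflagged δ′ m
    total m = trans (flagged+unflagged δ m) (sym (flagged+unflagged δ′ m))
    below-zero : ∀ δ → countAt L (λ x → not (δ x) ∧ P x) (λ x → suc (D x)) 0 ≡ 0
    below-zero δ = count-false _ (λ x → ∧-zeroʳ (not (δ x) ∧ P x)) L
    same-one : flagged δ 1 ≡ flagged δ′ 1
    same-one = begin
      flagged δ 1                                                       ≡⟨ sym (ℕ.+-identityʳ _) ⟩
      flagged δ 1 + 0                                                   ≡⟨ cong (flagged δ 1 +_) (sym (below-zero δ)) ⟩
      flagged δ 1 + countAt L (λ x → not (δ x) ∧ P x) (λ x → suc (D x)) 0 ≡⟨ sym (countAt-reflected V δ reflection-δ 0) ⟩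
      countAt L P V 0                                                   ≡⟨ V≗V′ 0 ⟩
      countAt L P V′ 0                                                  ≡⟨ countAt-reflected V′ δ′ reflection-δ′ 0 ⟩
      flagged δ′ 1 + countAt L (λ x → not (δ′ x) ∧ P x) (λ x → suc (D x)) 0 ≡⟨ cong (flagged δ′ 1 +_) (below-zero δ′) ⟩
      flagged δ′ 1 + 0                                                  ≡⟨ ℕ.+-identityʳ _ ⟩
      flagged δ′ 1                                                      ∎
      where open ≡-Reasoning
    same-step : ∀ k → flagged δ (2 + k) + unflagged δ k ≡ flagged δ′ (2 + k) + unflagged δ′ k
    same-step k = trans (sym (countAt-reflected V δ reflection-δ (suc k))) (trans (V≗V′ (suc k)) (countAt-reflected V′ δ′ reflection-δ′ (suc k)))
    same-flagged : ∀ m → flagged δ m ≡ flagged δ′ m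
    same-flagged = twoStep-unique (flagged δ) (unflagged δ) (flagged δ′) (unflagged δ′) total (trans zero-δ (sym zero-δ′)) same-one same-step
    same-unflagged : ∀ m → unflagged δ m ≡ unflagged δ′ m
    same-unflagged m = ℕ.+-cancelˡ-≡ (flagged δ m) _ _ (trans (total m) (cong (_+ unflagged δ′ m) (sym (same-flagged m))))

module CoordinatesAlike {n : ℕ} (C : Code n) (cr : CompletelyRegular (extend C)) {u : Vec Bool n} (u∈C : C u ≡ true) where

  extDist : Vec Bool n → ℕ
  extDist x = dist (parityExt u) (parityExt x)

  open Flagged (allVecs n) C extDist public

  differsAt : Fin (suc n) → Vec Bool n → Bool
  differsAt c x = lookup (parityExt u) c xor lookup (parityExt x) c

  differsAt-fromℕ : ∀ x → differsAt (fromℕ n) x ≡ parity u xor parity x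
  differsAt-fromℕ x = cong₂ _xor_ (lookup-∷ʳ-fromℕ u (parity u)) (lookup-∷ʳ-fromℕ x (parity x))

  differsAt-inject₁ : ∀ j x → differsAt (inject₁ j) x ≡ lookup u j xor lookup x j
  differsAt-inject₁ j x = cong₂ _xor_ (lookup-∷ʳ-inject₁ u (parity u) j) (lookup-∷ʳ-inject₁ x (parity x) j)

  extDist-fromℕ : ∀ x → extDist x ≡ ind (differsAt (fromℕ n) x) + dist u x
  extDist-fromℕ x = trans (dist-∷ʳ u x _ _) (cong (λ b → ind b + dist u x) (sym (differsAt-fromℕ x)))

  extDist-inject₁ : ∀ i x → extDist x ≡ ind (differsAt (inject₁ i) x) + dist (tau i u) (tau i x)
  extDist-inject₁ i x = trans (dist-∷ʳ u x _ _) (trans (sym (dist-[]≔ u x i (parity u) (parity x)))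
    (cong (λ b → ind b + dist (tau i u) (tau i x)) (sym (differsAt-inject₁ i x))))

  alike : ∀ c c′ → (∀ m → flagged (differsAt c) m ≡ flagged (differsAt c′) m)
                 × (∀ m → unflagged (differsAt c) m ≡ unflagged (differsAt c′) m)
  alike c c′ = flagged-determined (probeDist c) (probeDist c′) (differsAt c) (differsAt c′)
    (reflection c) (reflection c′) (noFlagAtZero c) (noFlagAtZero c′) sameDistribution
    where
    probe : Fin (suc n) → Vec Bool (suc n)
    probe c = flipAt (parityExt u) c
    probeDist : Fin (suc n) → Vec Bool n → ℕ
    probeDist c x = dist (probe c) (parityExt x)
    reflection : ∀ c → IsReflection (probeDist c) (differsAt c)
    reflection c x = dist-flipAt (parityExt u) (parityExt x) c
    noFlagAtZero : ∀ c → flagged (differsAt c) 0 ≡ 0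
    noFlagAtZero c = count-false _ noFlag (allVecs n)
      where
      noFlag : ∀ x → (differsAt c x ∧ C x) ∧ (extDist x ≡ᵇ 0) ≡ false
      noFlag x with extDist x in d
      ... | suc _ = ∧-zeroʳ _
      ... | zero  = cong (λ b → (b ∧ C x) ∧ true)
        (trans (cong (λ z → lookup z c xor lookup (parityExt x) c) (dist≡0⇒≡ (parityExt u) (parityExt x) d)) (xor-same (lookup (parityExt x) c)))
    probeAtOne : ∀ c → distToCode (extend C) (probe c) ≡ 1
    probeAtOne c = distToCode≡1 (extend C) (probe c) (flipAt-∉-extend C (parityExt u) c (parity-parityExt u))
      (trans (extend-parityExt C u) u∈C) (dist-flipAt-self (parityExt u) c)
    sameDistribution : ∀ k → countAt (allVecs n) C (probeDist c) k ≡ countAt (allVecs n) C (probeDist c′) k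
    sameDistribution k = trans (sym (B-extend C (probe c) k))
      (trans (cr (probe c) (probe c′) (trans (probeAtOne c) (sym (probeAtOne c′))) k) (B-extend C (probe c′) k))

  distanceDistribution-tau : ∀ i w → B C u w ≡ countAt (allVecs n) C (λ x → dist (tau i u) (tau i x)) w
  distanceDistribution-tau i w = begin
      B C u w
    ≡⟨ countAt-lowered (dist u) (differsAt (fromℕ n)) extDist-fromℕ w ⟩
      flagged (differsAt (fromℕ n)) (suc w) + unflagged (differsAt (fromℕ n)) w
    ≡⟨ cong₂ _+_ (proj₁ (alike _ _) (suc w)) (proj₂ (alike _ _) w) ⟩
      flagged (differsAt (inject₁ i)) (suc w) + unflagged (differsAt (inject₁ i)) w
    ≡⟨ sym (countAt-lowered _ (differsAt (inject₁ i)) (extDist-inject₁ i) w) ⟩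
      countAt (allVecs n) C (λ x → dist (tau i u) (tau i x)) w ∎
    where open ≡-Reasoning

B-tauCode : ∀ {n} (C : Code n) → CompletelyRegular (extend C) → ∀ {u} → C u ≡ true
  → ∀ i k → B C u k ≡ B (tauCode i C) (tau i u) k
B-tauCode {n} C cr {u} u∈C i k = begin
    B C u k
  ≡⟨ CoordinatesAlike.distanceDistribution-tau C cr u∈C i k ⟩
    count (λ x → C x ∧ (dist (tau i u) (tau i x) ≡ᵇ k)) (allVecs n)
  ≡⟨ count-cong (λ x → cong (_∧ _) (sym (tauCode-tau i C x))) (allVecs n) ⟩
    count (λ x → tauCode i C (tau i x) ∧ (dist (tau i u) (tau i x) ≡ᵇ k)) (allVecs n)
  ≡⟨ count-∘-involution (tau i) (tau-involutive i) (λ y → tauCode i C y ∧ (dist (tau i u) y ≡ᵇ k)) ⟩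
    B (tauCode i C) (tau i u) k ∎
  where open ≡-Reasoning

minDist-odd : ∀ {n} (C : Code n) → CompletelyRegular (extend C) → ∀ {d} → IsMinDist C d → Odd d
minDist-odd {n} C cr {d} ((u , v , u∈C , v∈C , u≢v , uv≡d) , least) with parity u xor parity v in puv
... | true  = oddᵇ⇒Odd d (subst (λ k → oddᵇ k ≡ true) uv≡d (trans (oddᵇ-dist u v) puv))
... | false with differing-coordinate u v u≢v
...   | j , u≢ⱼv = ⊥-elim (closerPair (countAt-witness (allVecs n) _ extDist parityBit-flagged))
  where
  open CoordinatesAlike C cr u∈C
  extDist-v : extDist v ≡ d
  extDist-v = trans (dist-∷ʳ u v _ _) (trans (cong (λ b → ind b + dist u v) puv) uv≡d)
  coordinate-flagged : 1 ≤ flagged (differsAt (inject₁ j)) d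
  coordinate-flagged = subst (λ m → 1 ≤ flagged (differsAt (inject₁ j)) m) extDist-v
    (countAt-pos (allVecs n) _ extDist (∈-allVecs v) (cong₂ _∧_ (trans (differsAt-inject₁ j v) u≢ⱼv) v∈C))
  parityBit-flagged : 1 ≤ flagged (differsAt (fromℕ n)) d
  parityBit-flagged = subst (1 ≤_) (sym (proj₁ (alike (fromℕ n) (inject₁ j)) d)) coordinate-flagged
  closerPair : (∃ λ x → (differsAt (fromℕ n) x ∧ C x) ≡ true × extDist x ≡ d) → ⊥
  closerPair (x , x-flagged , extDist-x) = ℕ.n≮n (dist u x) (subst (_≤ dist u x) (sym ux≡d-1) (least u x u∈C x∈C u≢x))
    where
    x-differs : differsAt (fromℕ n) x ≡ true
    x-differs = ∧-conicalˡ _ _ x-flagged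
    x∈C : C x ≡ true
    x∈C = ∧-conicalʳ _ _ x-flagged
    ux≡d-1 : suc (dist u x) ≡ d
    ux≡d-1 = trans (cong (λ b → ind b + dist u x) (sym x-differs)) (trans (sym (extDist-fromℕ x)) extDist-x)
    u≢x : u ≢ x
    u≢x u≡x with () ← trans (sym x-differs)
      (trans (cong (differsAt (fromℕ n)) (sym u≡x)) (trans (differsAt-fromℕ u) (xor-same (parity u))))

IsMinDist-transport : ∀ {N} {D D′ : Code N} (φ : Vec Bool N → Vec Bool N)
  → (∀ {u} → D u ≡ true → D′ (φ u) ≡ true)
  → (∀ {y} → D′ y ≡ true → ∃ λ u → D u ≡ true × φ u ≡ y)
  → (∀ {u} → D u ≡ true → ∀ k → B D u k ≡ B D′ (φ u) k)
  → ∀ {d} → IsMinDist D d → IsMinDist D′ d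
IsMinDist-transport {N} {D} {D′} φ φ-into φ-onto B≡ {d} ((u , v , u∈D , v∈D , u≢v , uv≡d) , least) =
  pairFrom (countAt-witness (allVecs N) D′ (dist (φ u)) atDistance-d) , least′
  where
  atDistance-d : 1 ≤ B D′ (φ u) d
  atDistance-d = subst (1 ≤_) (B≡ u∈D d) (subst (λ k → 1 ≤ B D u k) uv≡d (countAt-pos (allVecs N) D (dist u) (∈-allVecs v) v∈D))
  pairFrom : (∃ λ y → D′ y ≡ true × dist (φ u) y ≡ d)
    → ∃ λ y₁ → ∃ λ y₂ → D′ y₁ ≡ true × D′ y₂ ≡ true × y₁ ≢ y₂ × dist y₁ y₂ ≡ d
  pairFrom (y , y∈D′ , φuy≡d) =
    φ u , y , φ-into u∈D , y∈D′ , dist≢0⇒≢ (subst (_≢ 0) (trans uv≡d (sym φuy≡d)) (≢⇒dist≢0 u≢v)) , φuy≡d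
  least′ : ∀ y y′ → D′ y ≡ true → D′ y′ ≡ true → y ≢ y′ → d ≤ dist y y′
  least′ y y′ y∈D′ y′∈D′ y≢y′ with φ-onto y∈D′
  ... | u′ , u′∈D , refl with countAt-witness (allVecs N) D (dist u′)
          (subst (1 ≤_) (sym (B≡ u′∈D (dist (φ u′) y′))) (countAt-pos (allVecs N) D′ (dist (φ u′)) (∈-allVecs y′) y′∈D′))
  ...   | x , x∈D , u′x≡ = subst (d ≤_) u′x≡ (least u′ x u′∈D x∈D (dist≢0⇒≢ (subst (_≢ 0) (sym u′x≡) (≢⇒dist≢0 y≢y′))))

externalDistance-cong : ∀ {N} (D D′ : Code N) → (∀ k → pairCount D k ≡ pairCount D′ k)
  → externalDistance D ≡ externalDistance D′
externalDistance-cong {N} D D′ same =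
  cong (_∸ 1) (count-cong (λ k → cong (λ z → not ⌊ z ℤ.≟ ℤ.+ 0 ⌋) (dualTerm-cong k)) (upTo (suc N)))
  where
  dualTerm-cong : ∀ k → dualTerm D k ≡ dualTerm D′ k
  dualTerm-cong k = foldr-cong (λ j acc → cong (λ z → ℤ.+ z ℤ.* krawtchouk N k j ℤ.+ acc) (same j)) refl (upTo (suc N))

module _ {n : ℕ} (C : Code n) (i : Fin n) where

  weightDist-tauCode : ContainsZero C → CompletelyRegular (extend C) → ∀ w → weightDist C w ≡ weightDist (tauCode i C) w
  weightDist-tauCode 0∈C cr w = begin
      weightDist C w
    ≡⟨ count-cong (λ v → cong (λ t → C v ∧ (t ≡ᵇ w)) (weight≡dist-zeroVec v)) (allVecs n) ⟩
      B C (zeroVec n) w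
    ≡⟨ B-tauCode C cr 0∈C i w ⟩
      B (tauCode i C) (tau i (zeroVec n)) w
    ≡⟨ cong (λ z → B (tauCode i C) z w) (tau-zeroVec i) ⟩
      B (tauCode i C) (zeroVec n) w
    ≡⟨ count-cong (λ v → cong (λ t → tauCode i C v ∧ (t ≡ᵇ w)) (sym (weight≡dist-zeroVec v))) (allVecs n) ⟩
      weightDist (tauCode i C) w ∎
    where open ≡-Reasoning

  pairCount-tauCode : CompletelyRegular (extend C) → ∀ k → pairCount C k ≡ pairCount (tauCode i C) k
  pairCount-tauCode cr k = trans (sumBy-cong pairsFrom (allVecs n))
    (sumBy-∘-involution (tau i) (tau-involutive i) (λ y → if tauCode i C y then B (tauCode i C) y k else 0))
    where
    pairsFrom : ∀ u → (if C u then B C u k else 0) ≡ (if tauCode i C (tau i u) then B (tauCode i C) (tau i u) k else 0)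
    pairsFrom u rewrite tauCode-tau i C u with C u in u∈C
    ... | true  = B-tauCode C cr u∈C i k
    ... | false = refl

  minDist-tauCode : CompletelyRegular (extend C) → ∀ {d} → IsMinDist C d → IsMinDist (tauCode i C) d
  minDist-tauCode cr = IsMinDist-transport (tau i) (λ u∈C → trans (tauCode-tau i C _) u∈C)
    (λ {y} y∈ → tau i y , trans (sym (tauCode-correct i C y)) y∈ , tau-involutive i y)
    (λ u∈C k → B-tauCode C cr u∈C i k)

  minDist-tauCode⁻ : CompletelyRegular (extend C) → ∀ {d} → IsMinDist (tauCode i C) d → IsMinDist C d
  minDist-tauCode⁻ cr = IsMinDist-transport (tau i) (λ {y} y∈ → trans (sym (tauCode-correct i C y)) y∈)
    (λ {u} u∈C → tau i u , trans (tauCode-tau i C u) u∈C , tau-involutive i u)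
    (λ {y} y∈ k → trans (cong (λ z → B (tauCode i C) z k) (sym (tau-involutive i y)))
                        (sym (B-tauCode C cr (trans (sym (tauCode-correct i C y)) y∈) i k)))

  coveringRadius-tauCode : ∀ {v₀} → C v₀ ≡ true → coveringRadius C ≡ coveringRadius (tauCode i C)
  coveringRadius-tauCode v₀∈C = ℕ.≤-antisym
    (coveringRadius-≤-tau i (tauCode i C) C (λ y → sym (tauCode-tau i C y)) (trans (tauCode-tau i C _) v₀∈C))
    (coveringRadius-≤-tau i C (tauCode i C) (tauCode-correct i C) v₀∈C)

mainTheorem3 : (n : ℕ) (C : Code n)
    → ContainsZero C → DistanceInvariant C
    → CompletelyRegular (extend C)
    → (i : Fin n)
    → ((w : ℕ) → weightDist C w ≡ weightDist (tauCode i C) w)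
      × ((d : ℕ) → (IsMinDist C d → IsMinDist (tauCode i C) d × Odd d)
                   × (IsMinDist (tauCode i C) d → IsMinDist C d))
      × externalDistance C ≡ externalDistance (tauCode i C)
      × coveringRadius C ≡ coveringRadius (tauCode i C)
mainTheorem3 n C 0∈C _ cr i =
    weightDist-tauCode C i 0∈C cr
  , (λ d → (λ min → minDist-tauCode C i cr min , minDist-odd C cr min) , minDist-tauCode⁻ C i cr)
  , externalDistance-cong C (tauCode i C) (pairCount-tauCode C i cr)
  , coveringRadius-tauCode C i 0∈C
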